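{- Let $n\geq 1$ and let $v$ be the central vertex of the star $S_n$ (adjacent to all other vertices). Then $$\tau(\mathrm{Cone}(S_n))=2^{n-2}(n+1),\qquad \tau(\mathrm{Cone}^{(+v)}(S_n))=2^{n-2}(n+3).$$
   Context: $S_n=K_{1,n-1}$ is the star on $n$ vertices ($S_1$ is a single vertex, which is its central vertex). For a tree $T$, $\mathrm{Cone}(T)$ is obtained by adding a new cone vertex $v_0$ joined by one edge to each vertex of $T$; $\mathrm{Cone}^{(+u)}(T)$ is $\mathrm{Cone}(T)$ with a second edge added parallel to $\{v_0,u\}$. $\tau(G)$ is the number of spanning trees of the multigraph $G$. -}

module Defs where

open import Data.Nat using (ℕ; zero; suc; _+_; pred; NonZero)
open import Data.Fin using (Fin; zero; suc; inject+; raise; splitAt; _≟_)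
open import Data.Fin.Subset using (Subset; inside)
open import Data.Vec using (lookup; _[_]≔_)
open import Data.Bool using (Bool; true; false)
open import Data.Product using (_×_; _,_)
open import Data.Sum using ([_,_])
open import Data.List using (List; length)
open import Data.List.Membership.Propositional using (_∈_)
open import Data.List.Relation.Unary.Unique.Propositional using (Unique)
open import Relation.Binary.PropositionalEquality using (_≡_)
open import Function.Bundles using (_⇔_)
open import Relation.Nullary using (¬_)

record Multigraph : Set where
  field
    V    : ℕ
    E    : ℕ
    ends : Fin E → Fin V × Fin V
open Multigraph public

data Reach (G : Multigraph) (S : Subset (E G)) : Fin (V G) → Fin (V G) → Set where
  here : ∀ {u} → Reach G S u u
  fwd  : ∀ {a b w} (e : Fin (E G)) → lookup S e ≡ inside → ends G e ≡ (a , b) →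
         Reach G S b w → Reach G S a w
  bwd  : ∀ {a b w} (e : Fin (E G)) → lookup S e ≡ inside → ends G e ≡ (a , b) →
         Reach G S a w → Reach G S b w

Connected : (G : Multigraph) → Subset (E G) → Set
Connected G S = ∀ u w → Reach G S u w

-- Acyclic: no edge of S lies on a cycle, i.e. removing any edge e of S
-- disconnects its endpoints (in particular no loops).
Acyclic : (G : Multigraph) → Subset (E G) → Set
Acyclic G S = ∀ e a b → lookup S e ≡ inside → ends G e ≡ (a , b) →
              ¬ Reach G (S [ e ]≔ false) a b

IsSpanningTree : (G : Multigraph) → Subset (E G) → Set
IsSpanningTree G S = Connected G S × Acyclic G S

record τ≡ (G : Multigraph) (k : ℕ) : Set where
  field
    trees    : List (Subset (E G))
    unique   : Unique trees
    complete : ∀ S → (S ∈ trees) ⇔ IsSpanningTree G S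
    size     : length trees ≡ k

Star : (n : ℕ) → .{{NonZero n}} → Multigraph
Star (suc k) = record { V = suc k ; E = k ; ends = λ i → (zero , suc i) }

centre : (n : ℕ) → .{{_ : NonZero n}} → Fin (V (Star n))
centre (suc k) = zero

-- Cone(G): new vertex v₀ = zero, old vertices shifted by suc; edges of G first,
-- then one cone edge {v₀, suc j} for each old vertex j.
Cone : Multigraph → Multigraph
Cone G = record
  { V = suc (V G)
  ; E = E G + V G
  ; ends = λ i → [ (λ e → let (a , b) = ends G e in (suc a , suc b))
                 , (λ j → (zero , suc j)) ] (splitAt (E G) i)
  }

-- Cone^{(+u)}(G): Cone(G) with one extra edge parallel to {v₀, u}.
ConePlus : (G : Multigraph) → Fin (V G) → Multigraph
ConePlus G u = record
  { V = V (Cone G)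
  ; E = suc (E (Cone G))
  ; ends = λ { zero → (zero , suc u) ; (suc i) → ends (Cone G) i }
  }

-- Cone(S_n) is a book of n − 1 triangles apex–hub–leaf (apex = cone vertex, hub = centre of the
-- star) glued along the spine apex–hub.  An edge set is described by its spine bit and, at each
-- leaf, which of the hub and apex edges it keeps.
-- It is a spanning tree iff either it keeps the spine and exactly one edge at every leaf
-- (2^(n−1) trees), or it omits the spine, keeps both edges at exactly one leaf and one edge at
-- every other leaf ((n − 1)·2^(n−2) trees).  Doubling an edge e adds, for every spanning tree
-- through e, the tree using the copy instead; so Cone^(+v)(S_n) has 2^(n−1) trees more.
module Submission where

open import Defs
open import Data.Bool using (Bool; true; false)
open import Data.Empty using (⊥; ⊥-elim)
open import Data.Fin using (Fin; zero; suc; _↑ˡ_; _↑ʳ_) renaming (_≟_ to _≟ᶠ_)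
open import Data.Fin.Properties using (suc-injective; splitAt-↑ˡ; splitAt-↑ʳ)
open import Data.List using (List; []; _∷_; _++_; map; length; cartesianProductWith)
open import Data.List.Membership.Propositional using (_∈_)
open import Data.List.Membership.Propositional.Properties
  using (∈-map⁺; ∈-map⁻; ∈-++⁺ˡ; ∈-++⁺ʳ; ∈-++⁻
        ; ∈-cartesianProductWith⁺; ∈-cartesianProductWith⁻)
open import Data.List.Properties using (length-++; length-map)
open import Data.List.Relation.Unary.All using ([]; _∷_)
import Data.List.Relation.Unary.All as ListAll
import Data.List.Relation.Unary.All.Properties as ListAll
open import Data.List.Relation.Unary.AllPairs using ([]; _∷_)
open import Data.List.Relation.Unary.Any using (here; there)
open import Data.List.Relation.Unary.Unique.Propositional using (Unique)
import Data.List.Relation.Unary.Unique.Propositional.Properties as Unique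
open import Data.Nat using (ℕ; zero; suc; _+_; _*_; _^_; _∸_; NonZero)
open import Data.Nat.Properties using (*-distribˡ-+)
open import Data.Nat.Tactic.RingSolver using (solve-∀)
open import Data.Product using (_×_; _,_; proj₁; proj₂; ∃-syntax; Σ-syntax)
open import Data.Sum using (_⊎_; inj₁; inj₂; [_,_]) renaming (map to ⊎-map)
open import Data.Vec using (Vec; []; _∷_; lookup; _[_]≔_)
import Data.Vec as Vec
open import Data.Vec.Properties
  using ( lookup∘update; lookup∘update′; []≔-idempotent; []≔-lookup; []≔-commutes
        ; []≔-++-↑ˡ; []≔-++-↑ʳ
        ; map-[]≔; lookup-map; lookup-++ˡ; lookup-++ʳ; ++-injective; ∷-injective; ∷-injectiveʳ
        ; map-id; map-<,>-zip; map-proj₁-zip; map-proj₂-zip)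
open import Data.Vec.Relation.Unary.All using (All; []; _∷_)
import Data.Vec.Relation.Unary.All.Properties as All
open import Function.Base using (_∘_)
open import Function.Bundles using (_⇔_; mk⇔; Equivalence)
open import Relation.Binary.PropositionalEquality
  using (_≡_; _≢_; refl; sym; trans; cong; cong₂; subst; module ≡-Reasoning)
open import Relation.Nullary using (¬_; yes; no)

module _ {G : Multigraph} {S : Vec Bool (E G)} where

  Reach-trans : ∀ {u v w} → Reach G S u v → Reach G S v w → Reach G S u w
  Reach-trans here           q = q
  Reach-trans (fwd e l eq p) q = fwd e l eq (Reach-trans p q)
  Reach-trans (bwd e l eq p) q = bwd e l eq (Reach-trans p q)

  Reach-sym : ∀ {u w} → Reach G S u w → Reach G S w u
  Reach-sym here           = here
  Reach-sym (fwd e l eq p) = Reach-trans (Reach-sym p) (bwd e l eq here)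
  Reach-sym (bwd e l eq p) = Reach-trans (Reach-sym p) (fwd e l eq here)

Respects : {A : Set} (G : Multigraph) → Vec Bool (E G) → (Fin (V G) → A) → Set
Respects G S f = ∀ e {a b} → lookup S e ≡ true → ends G e ≡ (a , b) → f a ≡ f b

Reach-respects : ∀ {A : Set} {G S} {f : Fin (V G) → A} → Respects G S f →
                 ∀ {u w} → Reach G S u w → f u ≡ f w
Reach-respects r here           = refl
Reach-respects r (fwd e l eq p) = trans (r e l eq) (Reach-respects r p)
Reach-respects r (bwd e l eq p) = trans (sym (r e l eq)) (Reach-respects r p)

Reach-map : ∀ {v m m′} {g : Fin m → Fin v × Fin v} {g′ : Fin m′ → Fin v × Fin v}
            {S : Vec Bool m} {T : Vec Bool m′} (φ : Fin m → Fin m′) →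
            (∀ e → lookup S e ≡ true → lookup T (φ e) ≡ true × g′ (φ e) ≡ g e) →
            ∀ {u w} → Reach (record { V = v ; E = m ; ends = g }) S u w →
                      Reach (record { V = v ; E = m′ ; ends = g′ }) T u w
Reach-map φ hφ here           = here
Reach-map φ hφ (fwd e l eq p) = fwd (φ e) (proj₁ (hφ e l)) (trans (proj₂ (hφ e l)) eq) (Reach-map φ hφ p)
Reach-map φ hφ (bwd e l eq p) = bwd (φ e) (proj₁ (hφ e l)) (trans (proj₂ (hφ e l)) eq) (Reach-map φ hφ p)

[]≔-restore : ∀ {A : Set} {n} (xs : Vec A n) i {x y} → lookup xs i ≡ x → (xs [ i ]≔ y) [ i ]≔ x ≡ xs
[]≔-restore xs i refl = trans ([]≔-idempotent xs i) ([]≔-lookup xs i)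

lookup-[]≔-true : ∀ {n} (S : Vec Bool n) i j → lookup S j ≡ true → lookup (S [ i ]≔ true) j ≡ true
lookup-[]≔-true S i j l with j ≟ᶠ i
... | yes refl = lookup∘update i S true
... | no j≢i   = trans (lookup∘update′ j≢i S true) l

map-[]≔-unchanged : ∀ {A B : Set} {n x} (f : A → B) (xs : Vec A n) i → f (lookup xs i) ≡ f x →
                    Vec.map f (xs [ i ]≔ x) ≡ Vec.map f xs
map-[]≔-unchanged f xs i fx = begin
  Vec.map f (xs [ i ]≔ _)                     ≡⟨ map-[]≔ f xs i ⟩
  Vec.map f xs [ i ]≔ f _                     ≡⟨ cong (Vec.map f xs [ i ]≔_) (sym (trans (lookup-map i f xs) fx)) ⟩
  Vec.map f xs [ i ]≔ lookup (Vec.map f xs) i ≡⟨ []≔-lookup (Vec.map f xs) i ⟩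
  Vec.map f xs                                ∎
  where open ≡-Reasoning

record Enumerates {A : Set} (P : A → Set) (xs : List A) : Set where
  field
    unique   : Unique xs
    complete : ∀ x → x ∈ xs ⇔ P x
open Enumerates

τ≡-length : ∀ {G xs} → Enumerates (IsSpanningTree G) xs → τ≡ G (length xs)
τ≡-length {xs = xs} en = record { trees = xs ; unique = unique en ; complete = complete en ; size = refl }

module _ {A : Set} {P Q : A → Set} where
  open Equivalence

  enum-⇔ : ∀ {xs} → (∀ x → P x ⇔ Q x) → Enumerates P xs → Enumerates Q xs
  enum-⇔ P⇔Q en = record
    { unique   = unique en
    ; complete = λ x → mk⇔ (λ x∈ → to (P⇔Q x) (to (complete en x) x∈))
                            (λ q → from (complete en x) (from (P⇔Q x) q)) }

  enum-++ : ∀ {xs ys} → (∀ x → P x → Q x → ⊥) → Enumerates P xs → Enumerates Q ys →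
            Enumerates (λ x → P x ⊎ Q x) (xs ++ ys)
  enum-++ {xs} disjoint enP enQ = record
    { unique   = Unique.++⁺ (unique enP) (unique enQ)
                   (λ (x∈xs , x∈ys) → disjoint _ (to (complete enP _) x∈xs) (to (complete enQ _) x∈ys))
    ; complete = λ x → mk⇔ (λ x∈ → ⊎-map (to (complete enP x)) (to (complete enQ x)) (∈-++⁻ xs x∈))
                            λ { (inj₁ p) → ∈-++⁺ˡ (from (complete enP x) p)
                              ; (inj₂ q) → ∈-++⁺ʳ xs (from (complete enQ x) q) } }

enum-partition : ∀ {A : Set} {P : A → Set} {xs ys} (f : A → Bool) →
                 Enumerates (λ x → P x × f x ≡ true) xs → Enumerates (λ x → P x × f x ≡ false) ys →
                 Enumerates P (xs ++ ys)
enum-partition {P = P} f enT enF = enum-⇔ (λ x → mk⇔ [ proj₁ , proj₁ ] (split x)) (enum-++ disjoint enT enF)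
  where
  split : ∀ x → P x → (P x × f x ≡ true) ⊎ (P x × f x ≡ false)
  split x p with f x
  ... | true  = inj₁ (p , refl)
  ... | false = inj₂ (p , refl)
  disjoint : ∀ x → P x × f x ≡ true → P x × f x ≡ false → ⊥
  disjoint x (_ , t) (_ , u) with () ← trans (sym t) u

unique-map : ∀ {A B : Set} (f : A → B) {xs : List A} →
             (∀ {x y} → x ∈ xs → y ∈ xs → f x ≡ f y → x ≡ y) → Unique xs → Unique (map f xs)
unique-map f inj []          = []
unique-map f inj (x∉xs ∷ u) =
  ListAll.map⁺ (ListAll.tabulate λ y∈xs fx≡fy →
                  ListAll.lookup x∉xs y∈xs (inj (here refl) (there y∈xs) fx≡fy))
  ∷ unique-map f (λ x∈ y∈ → inj (there x∈) (there y∈)) u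

enum-map : ∀ {A B : Set} {P : A → Set} {xs} (f : A → B) →
           (∀ {x y} → P x → P y → f x ≡ f y → x ≡ y) → Enumerates P xs →
           Enumerates (λ y → ∃[ x ] P x × f x ≡ y) (map f xs)
enum-map f inj en = record
  { unique   = unique-map f (λ x∈ y∈ → inj (to (complete en _) x∈) (to (complete en _) y∈)) (unique en)
  ; complete = λ y → mk⇔ (λ y∈ → let x , x∈ , y≡fx = ∈-map⁻ f y∈
                                 in x , to (complete en x) x∈ , sym y≡fx)
                          λ { (x , p , refl) → ∈-map⁺ f (from (complete en x) p) } }
  where open Equivalence

conses : ∀ {A : Set} {k} → List A → List (Vec A k) → List (Vec A (suc k))
conses = cartesianProductWith _∷_

enum-conses : ∀ {A : Set} {k} {P : A → Set} {Q : Vec A k → Set} {xs ys} →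
              Enumerates P xs → Enumerates Q ys →
              Enumerates (λ v → P (Vec.head v) × Q (Vec.tail v)) (conses xs ys)
enum-conses {P = P} {Q} {xs} {ys} enP enQ = record
  { unique   = Unique.cartesianProductWith⁺ _∷_ ∷-injective (unique enP) (unique enQ)
  ; complete = λ { (a ∷ b) → mk⇔
      (λ v∈ → let a′ , b′ , a′∈ , b′∈ , eq = ∈-cartesianProductWith⁻ _∷_ xs ys v∈
                  a≡a′ , b≡b′ = ∷-injective eq
              in subst P (sym a≡a′) (to (complete enP a′) a′∈)
               , subst Q (sym b≡b′) (to (complete enQ b′) b′∈))
      (λ (p , q) → ∈-cartesianProductWith⁺ _∷_ (from (complete enP a) p) (from (complete enQ b) q)) } }
  where open Equivalence

length-conses : ∀ {A : Set} {k} (xs : List A) (ys : List (Vec A k)) →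
                length (conses xs ys) ≡ length xs * length ys
length-conses []       ys = refl
length-conses (x ∷ xs) ys = begin
  length (map (x ∷_) ys ++ conses xs ys)          ≡⟨ length-++ (map (x ∷_) ys) ⟩
  length (map (x ∷_) ys) + length (conses xs ys) ≡⟨ cong₂ _+_ (length-map (x ∷_) ys) (length-conses xs ys) ⟩
  length ys + length xs * length ys              ∎
  where open ≡-Reasoning

length-++-map : ∀ {A B C : Set} (f : A → C) (g : B → C) xs ys →
                length (map f xs ++ map g ys) ≡ length xs + length ys
length-++-map f g xs ys = trans (length-++ (map f xs)) (cong₂ _+_ (length-map f xs) (length-map g ys))

-- Doubling an edge

module ParallelEdge (G : Multigraph) (e : Fin (E G))
                    (ends⁺ : Fin (suc (E G)) → Fin (V G) × Fin (V G))
                    (ends⁺-zero : ends⁺ zero ≡ ends G e) (ends⁺-suc : ∀ f → ends⁺ (suc f) ≡ ends G f) where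

  H : Multigraph
  H = record { V = V G ; E = suc (E G) ; ends = ends⁺ }

  merge : Fin (E H) → Fin (E G)
  merge zero    = e
  merge (suc f) = f

  lift : ∀ {x S u w} → Reach G S u w → Reach H (x ∷ S) u w
  lift = Reach-map suc (λ f l → l , ends⁺-suc f)

  collapse-false : ∀ {S u w} → Reach H (false ∷ S) u w → Reach G S u w
  collapse-false = Reach-map merge λ { zero () ; (suc f) l → l , sym (ends⁺-suc f) }

  collapse-true : ∀ {S u w} → Reach H (true ∷ S) u w → Reach G (S [ e ]≔ true) u w
  collapse-true {S} = Reach-map merge λ { zero    _ → lookup∘update e S true , sym ends⁺-zero
                                        ; (suc f) l → lookup-[]≔-true S e f l , sym (ends⁺-suc f) }

  expand-true : ∀ {S u w} → Reach G (S [ e ]≔ true) u w → Reach H (true ∷ S) u w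
  expand-true {S} = Reach-map split kept
    where
    split : Fin (E G) → Fin (E H)
    split f with f ≟ᶠ e
    ... | yes _ = zero
    ... | no _  = suc f
    kept : ∀ f → lookup (S [ e ]≔ true) f ≡ true →
           lookup (true ∷ S) (split f) ≡ true × ends⁺ (split f) ≡ ends G f
    kept f l with f ≟ᶠ e
    ... | yes refl = refl , ends⁺-zero
    ... | no f≢e   = trans (sym (lookup∘update′ f≢e S true)) l , ends⁺-suc f

  tree-without-copy : ∀ S → IsSpanningTree H (false ∷ S) ⇔ IsSpanningTree G S
  tree-without-copy S = mk⇔
    (λ (conn , acyc) → (λ u w → collapse-false (conn u w))
                     , λ f a b l eq r → acyc (suc f) a b l (trans (ends⁺-suc f) eq) (lift r))
    (λ (conn , acyc) → (λ u w → lift (conn u w))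
                     , λ { zero a b ()
                         ; (suc f) a b l eq r → acyc f a b l (trans (sym (ends⁺-suc f)) eq) (collapse-false r) })

  tree-with-copy : ∀ S → IsSpanningTree H (true ∷ S) ⇔
                         (IsSpanningTree G (S [ e ]≔ true) × lookup S e ≡ false)
  tree-with-copy S = mk⇔ to from
    where
    to : IsSpanningTree H (true ∷ S) → IsSpanningTree G (S [ e ]≔ true) × lookup S e ≡ false
    to (conn , acyc) = ((λ u w → collapse-true (conn u w)) , acyc′) , absent
      where
      absent : lookup S e ≡ false
      absent with lookup S e in present
      ... | false = refl
      ... | true  = ⊥-elim (acyc zero _ _ refl ends⁺-zero (fwd (suc e) present (ends⁺-suc e) here))
      acyc′ : Acyclic G (S [ e ]≔ true)
      acyc′ f a b l eq r with f ≟ᶠ e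
      ... | yes refl = acyc zero a b refl (trans ends⁺-zero eq)
                         (lift (subst (λ T → Reach G T a b) ([]≔-restore S e absent) r))
      ... | no f≢e   = acyc (suc f) a b (trans (sym (lookup∘update′ f≢e S true)) l) (trans (ends⁺-suc f) eq)
                         (expand-true (subst (λ T → Reach G T a b) ([]≔-commutes S e f (f≢e ∘ sym)) r))
    from : IsSpanningTree G (S [ e ]≔ true) × lookup S e ≡ false → IsSpanningTree H (true ∷ S)
    from ((conn , acyc) , absent) = (λ u w → expand-true (conn u w)) , acyc′
      where
      acyc′ : Acyclic H (true ∷ S)
      acyc′ zero    a b _ eq r = acyc e a b (lookup∘update e S true) (trans (sym ends⁺-zero) eq)
                                   (subst (λ T → Reach G T a b) (sym ([]≔-restore S e absent)) (collapse-false r))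
      acyc′ (suc f) a b l eq r = acyc f a b (lookup-[]≔-true S e f l) (trans (sym (ends⁺-suc f)) eq)
                                   (subst (λ T → Reach G T a b) (sym ([]≔-commutes S e f e≢f)) (collapse-true r))
        where e≢f : e ≢ f
              e≢f refl with () ← trans (sym absent) l

  enum-trees : ∀ {ts us} → Enumerates (IsSpanningTree G) ts →
               Enumerates (λ T → IsSpanningTree G T × lookup T e ≡ true) us →
               Enumerates (IsSpanningTree H) (map (false ∷_) ts ++ map (λ T → true ∷ (T [ e ]≔ false)) us)
  enum-trees enT enU =
    enum-⇔ classify
      (enum-++ (λ { _ (_ , _ , refl) (_ , _ , ()) })
        (enum-map (false ∷_) (λ _ _ eq → ∷-injectiveʳ eq) enT)
        (enum-map (λ T → true ∷ (T [ e ]≔ false)) swap-injective enU))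
    where
    open Equivalence
    swap-injective : ∀ {T T′} → IsSpanningTree G T × lookup T e ≡ true →
                     IsSpanningTree G T′ × lookup T′ e ≡ true →
                     true ∷ (T [ e ]≔ false) ≡ true ∷ (T′ [ e ]≔ false) → T ≡ T′
    swap-injective {T} {T′} (_ , Te) (_ , T′e) eq = begin
      T                             ≡⟨ []≔-restore T e Te ⟨
      (T [ e ]≔ false) [ e ]≔ true  ≡⟨ cong (_[ e ]≔ true) (∷-injectiveʳ eq) ⟩
      (T′ [ e ]≔ false) [ e ]≔ true ≡⟨ []≔-restore T′ e T′e ⟩
      T′                            ∎
      where open ≡-Reasoning
    classify : ∀ S′ → ((∃[ S ] IsSpanningTree G S × false ∷ S ≡ S′) ⊎
                       (∃[ T ] (IsSpanningTree G T × lookup T e ≡ true) × true ∷ (T [ e ]≔ false) ≡ S′))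
                      ⇔ IsSpanningTree H S′
    classify (false ∷ S) = mk⇔
      (λ { (inj₁ (_ , t , refl)) → from (tree-without-copy S) t ; (inj₂ (_ , _ , ())) })
      (λ t → inj₁ (S , to (tree-without-copy S) t , refl))
    classify (true ∷ S) = mk⇔
      (λ { (inj₁ (_ , _ , ()))
         ; (inj₂ (T , (t , Te) , refl)) →
             from (tree-with-copy (T [ e ]≔ false))
               (subst (IsSpanningTree G) (sym ([]≔-restore T e Te)) t , lookup∘update e T false) })
      (λ t → let t′ , absent = to (tree-with-copy S) t
             in inj₂ (S [ e ]≔ true , (t′ , lookup∘update e S true)
                     , cong (true ∷_) ([]≔-restore S e absent)))

-- Choices at the leaves of a star

-- Whether the hub edge and whether the apex edge of one leaf are kept.
Choice : Set
Choice = Bool × Bool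

pattern none = false , false
pattern both = true , true

data Single : Choice → Set where
  hub-only  : Single (true , false)
  apex-only : Single (false , true)

data OneBoth : ∀ {k} → Vec Choice k → Set where
  here  : ∀ {k} {c : Vec Choice k} → All Single c → OneBoth (both ∷ c)
  there : ∀ {k x} {c : Vec Choice k} → Single x → OneBoth c → OneBoth (x ∷ c)

Shape : ∀ {k} → Vec Choice k → Bool → Set
Shape c true  = All Single c
Shape c false = OneBoth c

single-≢none : ∀ {x} → Single x → x ≢ none
single-≢none hub-only  ()
single-≢none apex-only ()

single-≢both : ∀ {x} → Single x → x ≢ both
single-≢both hub-only  ()
single-≢both apex-only ()

oneBoth-≢none : ∀ {k} {c : Vec Choice k} → OneBoth c → ∀ i → lookup c i ≢ none
oneBoth-≢none (here a)    zero    = λ ()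
oneBoth-≢none (here a)    (suc i) = single-≢none (All.lookup⁺ a i)
oneBoth-≢none (there s o) zero    = single-≢none s
oneBoth-≢none (there s o) (suc i) = oneBoth-≢none o i

shape-≢none : ∀ {k} {c : Vec Choice k} s → Shape c s → ∀ i → lookup c i ≢ none
shape-≢none true  a i = single-≢none (All.lookup⁺ a i)
shape-≢none false o i = oneBoth-≢none o i

oneBoth-index : ∀ {k} {c : Vec Choice k} → OneBoth c → ∃[ d ] lookup c d ≡ both
oneBoth-index (here _)    = zero , refl
oneBoth-index (there _ o) = let d , eq = oneBoth-index o in suc d , eq

oneBoth-replace : ∀ {k} {c : Vec Choice k} {x} → OneBoth c → ∀ i → lookup c i ≡ both → Single x →
                  All Single (c [ i ]≔ x)
oneBoth-replace (here a)    zero    _  s = s ∷ a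
oneBoth-replace (here a)    (suc i) eq _ = ⊥-elim (single-≢both (All.lookup⁺ a i) eq)
oneBoth-replace (there t o) zero    eq _ = ⊥-elim (single-≢both t eq)
oneBoth-replace (there t o) (suc i) eq s = t ∷ oneBoth-replace o i eq s

single-or-oneBoth : ∀ {k} (c : Vec Choice k) → (∀ i → lookup c i ≢ none) →
                    (∀ i j → lookup c i ≡ both → lookup c j ≡ both → i ≡ j) → All Single c ⊎ OneBoth c
single-or-oneBoth []      _       _           = inj₁ []
single-or-oneBoth (x ∷ c) no-none unique-both
  with single-or-oneBoth c (λ i → no-none (suc i)) (λ i j p q → suc-injective (unique-both (suc i) (suc j) p q))
single-or-oneBoth (none ∷ c)           no-none _ | _ = ⊥-elim (no-none zero refl)
single-or-oneBoth (both ∷ c)           _ _ | inj₁ a = inj₂ (here a)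
single-or-oneBoth (both ∷ c)           _ unique-both | inj₂ o
  with () ← unique-both zero (suc (proj₁ (oneBoth-index o))) refl (proj₂ (oneBoth-index o))
single-or-oneBoth ((true , false) ∷ c) _ _ | inj₁ a = inj₁ (hub-only ∷ a)
single-or-oneBoth ((true , false) ∷ c) _ _ | inj₂ o = inj₂ (there hub-only o)
single-or-oneBoth ((false , true) ∷ c) _ _ | inj₁ a = inj₁ (apex-only ∷ a)
single-or-oneBoth ((false , true) ∷ c) _ _ | inj₂ o = inj₂ (there apex-only o)

singleChoices : List Choice
singleChoices = (true , false) ∷ (false , true) ∷ []

singles : ∀ k → List (Vec Choice k)
singles zero    = [] ∷ []
singles (suc k) = conses singleChoices (singles k)

oneBoths : ∀ k → List (Vec Choice k)
oneBoths zero    = []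
oneBoths (suc k) = conses (both ∷ []) (singles k) ++ conses singleChoices (oneBoths k)

shapes : ∀ k → Bool → List (Vec Choice k)
shapes k true  = singles k
shapes k false = oneBoths k

enum-Single : Enumerates Single singleChoices
enum-Single = record
  { unique   = ((λ ()) ∷ []) ∷ [] ∷ []
  ; complete = λ x → mk⇔ (λ { (here refl) → hub-only ; (there (here refl)) → apex-only })
                         (λ { hub-only → here refl ; apex-only → there (here refl) }) }

enum-both : Enumerates {Choice} (_≡ both) (both ∷ [])
enum-both = record { unique = [] ∷ [] ; complete = λ x → mk⇔ (λ { (here eq) → eq }) here }

enum-singles : ∀ k → Enumerates (All Single) (singles k)
enum-singles zero    = record { unique = [] ∷ [] ; complete = λ { [] → mk⇔ (λ _ → []) (λ _ → here refl) } }
enum-singles (suc k) = enum-⇔ (λ { (x ∷ c) → mk⇔ (λ (s , a) → s ∷ a) (λ { (s ∷ a) → s , a }) })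
                              (enum-conses enum-Single (enum-singles k))

enum-oneBoths : ∀ k → Enumerates OneBoth (oneBoths k)
enum-oneBoths zero    = record { unique = [] ; complete = λ _ → mk⇔ (λ ()) (λ ()) }
enum-oneBoths (suc k) =
  enum-⇔ (λ { (x ∷ c) → mk⇔ (λ { (inj₁ (refl , a)) → here a ; (inj₂ (s , o)) → there s o })
                             (λ { (here a) → inj₁ (refl , a) ; (there s o) → inj₂ (s , o) }) })
         (enum-++ (λ { (_ ∷ _) (refl , _) (() , _) })
                  (enum-conses enum-both (enum-singles k)) (enum-conses enum-Single (enum-oneBoths k)))

enum-shapes : ∀ k s → Enumerates (λ c → Shape c s) (shapes k s)
enum-shapes k true  = enum-singles k
enum-shapes k false = enum-oneBoths k

length-singles : ∀ k → length (singles k) ≡ 2 ^ k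
length-singles zero    = refl
length-singles (suc k) = trans (length-conses singleChoices (singles k)) (cong (2 *_) (length-singles k))

length-oneBoths : ∀ k → 2 * length (oneBoths k) ≡ k * 2 ^ k
length-oneBoths zero    = refl
length-oneBoths (suc k) = begin
  2 * length (conses (both ∷ []) (singles k) ++ conses singleChoices (oneBoths k))
    ≡⟨ cong (2 *_) (length-++ (conses (both ∷ []) (singles k))) ⟩
  2 * (length (conses (both ∷ []) (singles k)) + length (conses singleChoices (oneBoths k)))
    ≡⟨ cong₂ (λ a b → 2 * (a + b)) (length-conses (both ∷ []) (singles k))
                                   (length-conses singleChoices (oneBoths k)) ⟩
  2 * (1 * length (singles k) + 2 * length (oneBoths k))
    ≡⟨ regroup (length (singles k)) (length (oneBoths k)) ⟩
  2 * length (singles k) + 2 * (2 * length (oneBoths k))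
    ≡⟨ cong₂ (λ a b → 2 * a + 2 * b) (length-singles k) (length-oneBoths k) ⟩
  2 * 2 ^ k + 2 * (k * 2 ^ k)
    ≡⟨ factor (2 ^ k) k ⟩
  suc k * (2 * 2 ^ k)
    ∎
  where
  open ≡-Reasoning
  regroup : ∀ p q → 2 * (1 * p + 2 * q) ≡ 2 * p + 2 * (2 * q)
  regroup = solve-∀
  factor : ∀ p k → 2 * p + 2 * (k * p) ≡ suc k * (2 * p)
  factor = solve-∀

-- The cone over a star

data SplitView (m n : ℕ) : Fin (m + suc n) → Set where
  left   : (i : Fin m) → SplitView m n (i ↑ˡ suc n)
  middle : SplitView m n (m ↑ʳ zero)
  right  : (j : Fin n) → SplitView m n (m ↑ʳ suc j)

splitView : ∀ m n e → SplitView m n e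
splitView zero    n zero    = middle
splitView zero    n (suc j) = right j
splitView (suc m) n zero    = left zero
splitView (suc m) n (suc e) with splitView m n e
... | left i  = left (suc i)
... | middle  = middle
... | right j = right j

module ConeOfStar (k : ℕ) where

  G : Multigraph
  G = Cone (Star (suc k))

  apex hub : Fin (V G)
  apex = zero
  hub  = suc zero

  leaf : Fin k → Fin (V G)
  leaf i = suc (suc i)

  hubEdge apexEdge : Fin k → Fin (E G)
  hubEdge i  = i ↑ˡ suc k
  apexEdge i = k ↑ʳ suc i

  spine : Fin (E G)
  spine = k ↑ʳ zero

  ends-hubEdge : ∀ i → ends G (hubEdge i) ≡ (hub , leaf i)
  ends-hubEdge i rewrite splitAt-↑ˡ k i (suc k) = refl

  ends-apexEdge : ∀ i → ends G (apexEdge i) ≡ (apex , leaf i)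
  ends-apexEdge i rewrite splitAt-↑ʳ k (suc k) (suc i) = refl

  ends-spine : ends G spine ≡ (apex , hub)
  ends-spine rewrite splitAt-↑ʳ k (suc k) zero = refl

  enc : Vec Choice k → Bool → Vec Bool (E G)
  enc c s = Vec.map proj₁ c Vec.++ (s ∷ Vec.map proj₂ c)

  enc-injective : ∀ {c c′ s s′} → enc c s ≡ enc c′ s′ → c ≡ c′ × s ≡ s′
  enc-injective {c} {c′} eq =
    let hubs , rest     = ++-injective (Vec.map proj₁ c) (Vec.map proj₁ c′) eq
        s≡s′ , apexes = ∷-injective rest
    in trans (zip-map c) (trans (cong₂ Vec.zip hubs apexes) (sym (zip-map c′))) , s≡s′
    where
    zip-map : ∀ (c : Vec Choice k) → c ≡ Vec.zip (Vec.map proj₁ c) (Vec.map proj₂ c)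
    zip-map c = trans (sym (map-id c)) (map-<,>-zip proj₁ proj₂ c)

  enc-surjective : ∀ S → ∃[ c ] ∃[ s ] enc c s ≡ S
  enc-surjective S with Vec.splitAt k S
  ... | hubs , s ∷ apexes , S≡ =
    Vec.zip hubs apexes , s ,
    trans (cong₂ (λ xs ys → xs Vec.++ (s ∷ ys)) (map-proj₁-zip hubs apexes) (map-proj₂-zip hubs apexes))
          (sym S≡)

  module _ (c : Vec Choice k) (s : Bool) where

    lookup-hubEdge : ∀ i → lookup (enc c s) (hubEdge i) ≡ proj₁ (lookup c i)
    lookup-hubEdge i = trans (lookup-++ˡ (Vec.map proj₁ c) _ i) (lookup-map i proj₁ c)

    lookup-apexEdge : ∀ i → lookup (enc c s) (apexEdge i) ≡ proj₂ (lookup c i)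
    lookup-apexEdge i = trans (lookup-++ʳ (Vec.map proj₁ c) _ (suc i)) (lookup-map i proj₂ c)

    lookup-spine : lookup (enc c s) spine ≡ s
    lookup-spine = lookup-++ʳ (Vec.map proj₁ c) _ zero

    hub-leaf : ∀ i → proj₁ (lookup c i) ≡ true → Reach G (enc c s) hub (leaf i)
    hub-leaf i p = fwd (hubEdge i) (trans (lookup-hubEdge i) p) (ends-hubEdge i) here

    apex-leaf : ∀ i → proj₂ (lookup c i) ≡ true → Reach G (enc c s) apex (leaf i)
    apex-leaf i p = fwd (apexEdge i) (trans (lookup-apexEdge i) p) (ends-apexEdge i) here

    apex-hub-via-leaf : ∀ i → lookup c i ≡ both → Reach G (enc c s) apex hub
    apex-hub-via-leaf i eq = Reach-trans (apex-leaf i (cong proj₂ eq)) (Reach-sym (hub-leaf i (cong proj₁ eq)))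

    apex-hub-via-spine : s ≡ true → Reach G (enc c s) apex hub
    apex-hub-via-spine p = fwd spine (trans lookup-spine p) ends-spine here

  delete-hubEdge : ∀ c s i {y} → lookup c i ≡ (true , y) →
                   enc c s [ hubEdge i ]≔ false ≡ enc (c [ i ]≔ (false , y)) s
  delete-hubEdge c s i ci = begin
    enc c s [ hubEdge i ]≔ false
      ≡⟨ []≔-++-↑ˡ (Vec.map proj₁ c) _ i ⟩
    (Vec.map proj₁ c [ i ]≔ false) Vec.++ (s ∷ Vec.map proj₂ c)
      ≡⟨ cong₂ (λ xs ys → xs Vec.++ (s ∷ ys))
               (sym (map-[]≔ proj₁ c i)) (sym (map-[]≔-unchanged proj₂ c i (cong proj₂ ci))) ⟩
    enc (c [ i ]≔ (false , _)) s
      ∎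
    where open ≡-Reasoning

  delete-apexEdge : ∀ c s i {x} → lookup c i ≡ (x , true) →
                    enc c s [ apexEdge i ]≔ false ≡ enc (c [ i ]≔ (x , false)) s
  delete-apexEdge c s i ci = begin
    enc c s [ apexEdge i ]≔ false
      ≡⟨ []≔-++-↑ʳ (Vec.map proj₁ c) (s ∷ Vec.map proj₂ c) (suc i) ⟩
    Vec.map proj₁ c Vec.++ (s ∷ (Vec.map proj₂ c [ i ]≔ false))
      ≡⟨ cong₂ (λ xs ys → xs Vec.++ (s ∷ ys))
               (sym (map-[]≔-unchanged proj₁ c i (cong proj₁ ci))) (sym (map-[]≔ proj₂ c i)) ⟩
    enc (c [ i ]≔ (_ , false)) s
      ∎
    where open ≡-Reasoning

  delete-spine : ∀ c s → enc c s [ spine ]≔ false ≡ enc c false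
  delete-spine c s = []≔-++-↑ʳ (Vec.map proj₁ c) _ zero

  leaf-isolated : ∀ c s i → lookup c i ≡ none → ∀ {u} → Reach G (enc c s) (leaf i) u → u ≡ leaf i
  leaf-isolated c s i none-i here = refl
  leaf-isolated c s i none-i (fwd e l eq r) with splitView k k e
  ... | left j  with () ← trans (sym (ends-hubEdge j)) eq
  ... | middle  with () ← trans (sym ends-spine) eq
  ... | right j with () ← trans (sym (ends-apexEdge j)) eq
  leaf-isolated c s i none-i (bwd e l eq r) with splitView k k e
  ... | left j  with refl ← trans (sym (ends-hubEdge j)) eq
                with () ← trans (sym l) (trans (lookup-hubEdge c s i) (cong proj₁ none-i))
  ... | middle  with () ← trans (sym ends-spine) eq
  ... | right j with refl ← trans (sym (ends-apexEdge j)) eq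
                with () ← trans (sym l) (trans (lookup-apexEdge c s i) (cong proj₂ none-i))

  colour : Bool → Bool → (Fin k → Bool) → Fin (V G) → Bool
  colour a h g zero          = a
  colour a h g (suc zero)    = h
  colour a h g (suc (suc i)) = g i

  respects-enc : ∀ c s {a h g} → (s ≡ true → a ≡ h) → (∀ i → proj₁ (lookup c i) ≡ true → h ≡ g i) →
                 (∀ i → proj₂ (lookup c i) ≡ true → a ≡ g i) → Respects G (enc c s) (colour a h g)
  respects-enc c s hs hh ha e l eq with splitView k k e
  ... | left i  with refl ← trans (sym (ends-hubEdge i)) eq  = hh i (trans (sym (lookup-hubEdge c s i)) l)
  ... | middle  with refl ← trans (sym ends-spine) eq        = hs (trans (sym (lookup-spine c s)) l)
  ... | right i with refl ← trans (sym (ends-apexEdge i)) eq = ha i (trans (sym (lookup-apexEdge c s i)) l)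

  spine-cut : ∀ c → All Single c → ¬ Reach G (enc c false) apex hub
  spine-cut c singles r =
    true≢false (Reach-respects (respects-enc c false {g = apex-side} (λ ()) hub-side (λ _ p → sym p)) r)
    where
    apex-side : Fin k → Bool
    apex-side j = proj₂ (lookup c j)
    hub-side : ∀ j → proj₁ (lookup c j) ≡ true → false ≡ apex-side j
    hub-side j = single-hub (All.lookup⁺ singles j)
      where single-hub : ∀ {x} → Single x → proj₁ x ≡ true → false ≡ proj₂ x
            single-hub hub-only  _  = refl
            single-hub apex-only ()
    true≢false : true ≢ false
    true≢false ()

  both-cut : ∀ c s i {x} → Shape c s → lookup c i ≡ both → Single x →
             ¬ Reach G (enc (c [ i ]≔ x) s) apex hub
  both-cut c true  i singles ci _ _ = single-≢both (All.lookup⁺ singles i) ci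
  both-cut c false i o       ci x   = spine-cut (c [ i ]≔ _) (oneBoth-replace o i ci x)

  shape-apex-hub : ∀ c s → Shape c s → Reach G (enc c s) apex hub
  shape-apex-hub c true  _ = apex-hub-via-spine c true refl
  shape-apex-hub c false o = let d , cd = oneBoth-index o in apex-hub-via-leaf c false d cd

  shape-connected : ∀ c s → Shape c s → Connected G (enc c s)
  shape-connected c s sh u w = Reach-trans (to-apex u) (Reach-sym (to-apex w))
    where
    to-apex : ∀ u → Reach G (enc c s) u apex
    to-apex zero          = here
    to-apex (suc zero)    = Reach-sym (shape-apex-hub c s sh)
    to-apex (suc (suc i)) with lookup c i in ci
    ... | (_ , true)     = Reach-sym (apex-leaf c s i (cong proj₂ ci))
    ... | (true , false) = Reach-sym (Reach-trans (shape-apex-hub c s sh) (hub-leaf c s i (cong proj₁ ci)))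
    ... | none           = ⊥-elim (shape-≢none s sh i ci)

  hubEdge-bridge : ∀ c s i → Shape c s → proj₁ (lookup c i) ≡ true →
                   ¬ Reach G (enc c s [ hubEdge i ]≔ false) hub (leaf i)
  hubEdge-bridge c s i sh p r with lookup c i in ci
  ... | (false , _)    with () ← p
  ... | (true , false) with () ← leaf-isolated (c [ i ]≔ none) s i (lookup∘update i c none)
                                   (Reach-sym (subst (λ T → Reach G T hub (leaf i)) (delete-hubEdge c s i ci) r))
  ... | (true , true)  = both-cut c s i sh ci apex-only
      (Reach-trans (apex-leaf (c [ i ]≔ _) s i (cong proj₂ (lookup∘update i c (false , true))))
                   (Reach-sym (subst (λ T → Reach G T hub (leaf i)) (delete-hubEdge c s i ci) r)))

  apexEdge-bridge : ∀ c s i → Shape c s → proj₂ (lookup c i) ≡ true →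
                    ¬ Reach G (enc c s [ apexEdge i ]≔ false) apex (leaf i)
  apexEdge-bridge c s i sh p r with lookup c i in ci
  ... | (_ , false)    with () ← p
  ... | (false , true) with () ← leaf-isolated (c [ i ]≔ none) s i (lookup∘update i c none)
                                   (Reach-sym (subst (λ T → Reach G T apex (leaf i)) (delete-apexEdge c s i ci) r))
  ... | (true , true)  = both-cut c s i sh ci hub-only
      (Reach-trans (subst (λ T → Reach G T apex (leaf i)) (delete-apexEdge c s i ci) r)
                   (Reach-sym (hub-leaf (c [ i ]≔ _) s i (cong proj₁ (lookup∘update i c (true , false))))))

  spine-bridge : ∀ c s → Shape c s → s ≡ true → ¬ Reach G (enc c s [ spine ]≔ false) apex hub
  spine-bridge c true singles _ r = spine-cut c singles (subst (λ T → Reach G T apex hub) (delete-spine c true) r)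

  shape-acyclic : ∀ c s → Shape c s → Acyclic G (enc c s)
  shape-acyclic c s sh e a b l eq with splitView k k e
  ... | left i  with refl ← trans (sym (ends-hubEdge i)) eq  =
    hubEdge-bridge c s i sh (trans (sym (lookup-hubEdge c s i)) l)
  ... | middle  with refl ← trans (sym ends-spine) eq        =
    spine-bridge c s sh (trans (sym (lookup-spine c s)) l)
  ... | right i with refl ← trans (sym (ends-apexEdge i)) eq =
    apexEdge-bridge c s i sh (trans (sym (lookup-apexEdge c s i)) l)

  spanning-≢none : ∀ c s → Connected G (enc c s) → ∀ i → lookup c i ≢ none
  spanning-≢none c s conn i ci with () ← leaf-isolated c s i ci (conn (leaf i) apex)

  spanning-both-unique : ∀ c s → Acyclic G (enc c s) →
                         ∀ i j → lookup c i ≡ both → lookup c j ≡ both → i ≡ j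
  spanning-both-unique c s acyc i j ci cj with i ≟ᶠ j
  ... | yes i≡j = i≡j
  ... | no i≢j  = ⊥-elim (acyc (apexEdge i) apex (leaf i)
                                (trans (lookup-apexEdge c s i) (cong proj₂ ci)) (ends-apexEdge i)
                                (subst (λ T → Reach G T apex (leaf i)) (sym (delete-apexEdge c s i ci)) cycle))
    where
    c′ = c [ i ]≔ (true , false)
    cycle : Reach G (enc c′ s) apex (leaf i)
    cycle = Reach-trans (apex-hub-via-leaf c′ s j (trans (lookup∘update′ (i≢j ∘ sym) c _) cj))
                        (hub-leaf c′ s i (cong proj₁ (lookup∘update i c (true , false))))

  spanning⇒shape : ∀ c s → IsSpanningTree G (enc c s) → Shape c s
  spanning⇒shape c s (conn , acyc)
    with single-or-oneBoth c (spanning-≢none c s conn) (spanning-both-unique c s acyc)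
  spanning⇒shape c true  (conn , acyc) | inj₁ singles = singles
  spanning⇒shape c false (conn , acyc) | inj₁ singles = ⊥-elim (spine-cut c singles (conn apex hub))
  spanning⇒shape c false (conn , acyc) | inj₂ o       = o
  spanning⇒shape c true  (conn , acyc) | inj₂ o       =
    let d , cd = oneBoth-index o
    in ⊥-elim (acyc spine apex hub (lookup-spine c true) ends-spine
                 (subst (λ T → Reach G T apex hub) (sym (delete-spine c true)) (apex-hub-via-leaf c false d cd)))

  spanning⇔shape : ∀ c s → IsSpanningTree G (enc c s) ⇔ Shape c s
  spanning⇔shape c s = mk⇔ (spanning⇒shape c s) (λ sh → shape-connected c s sh , shape-acyclic c s sh)

  trees-with-spine : ∀ s S → (∃[ c ] Shape c s × enc c s ≡ S) ⇔ (IsSpanningTree G S × lookup S spine ≡ s)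
  trees-with-spine s S = mk⇔ to from
    where
    to : ∃[ c ] Shape c s × enc c s ≡ S → IsSpanningTree G S × lookup S spine ≡ s
    to (c , sh , refl) = Equivalence.from (spanning⇔shape c s) sh , lookup-spine c s
    from : IsSpanningTree G S × lookup S spine ≡ s → ∃[ c ] Shape c s × enc c s ≡ S
    from (t , l) with enc-surjective S
    ... | c , s′ , refl with refl ← trans (sym (lookup-spine c s′)) l =
      c , Equivalence.to (spanning⇔shape c s′) t , refl

  enum-trees-with-spine : ∀ s → Enumerates (λ S → IsSpanningTree G S × lookup S spine ≡ s)
                                           (map (λ c → enc c s) (shapes k s))
  enum-trees-with-spine s =
    enum-⇔ (trees-with-spine s)
           (enum-map (λ c → enc c s) (λ _ _ eq → proj₁ (enc-injective eq)) (enum-shapes k s))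

  treesWithSpine : List (Vec Bool (E G))
  treesWithSpine = map (λ c → enc c true) (singles k)

  trees : List (Vec Bool (E G))
  trees = treesWithSpine ++ map (λ c → enc c false) (oneBoths k)

  enum-trees : Enumerates (IsSpanningTree G) trees
  enum-trees = enum-partition (λ S → lookup S spine) (enum-trees-with-spine true) (enum-trees-with-spine false)

  length-treesWithSpine : length treesWithSpine ≡ 2 ^ k
  length-treesWithSpine = trans (length-map _ (singles k)) (length-singles k)

  length-trees : 2 * length trees ≡ 2 ^ k * (suc k + 1)
  length-trees = begin
    2 * length trees
      ≡⟨ cong (2 *_) (length-++-map _ _ (singles k) (oneBoths k)) ⟩
    2 * (length (singles k) + length (oneBoths k))
      ≡⟨ *-distribˡ-+ 2 (length (singles k)) _ ⟩
    2 * length (singles k) + 2 * length (oneBoths k)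
      ≡⟨ cong₂ (λ a b → 2 * a + b) (length-singles k) (length-oneBoths k) ⟩
    2 * 2 ^ k + k * 2 ^ k
      ≡⟨ factor (2 ^ k) k ⟩
    2 ^ k * (suc k + 1)
      ∎
    where
    open ≡-Reasoning
    factor : ∀ p k → 2 * p + k * p ≡ p * (suc k + 1)
    factor = solve-∀

module DoubledSpineConeOfStar (k : ℕ) where
  open ConeOfStar k

  H : Multigraph
  H = ConePlus (Star (suc k)) (centre (suc k))

  trees⁺ : List (Vec Bool (E H))
  trees⁺ = map (false ∷_) trees ++ map (λ T → true ∷ (T [ spine ]≔ false)) treesWithSpine

  enum-trees⁺ : Enumerates (IsSpanningTree H) trees⁺
  enum-trees⁺ = ParallelEdge.enum-trees G spine (ends H) (sym ends-spine) (λ _ → refl)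
                  enum-trees (enum-trees-with-spine true)

  length-trees⁺ : 2 * length trees⁺ ≡ 2 ^ k * (suc k + 3)
  length-trees⁺ = begin
    2 * length trees⁺
      ≡⟨ cong (2 *_) (length-++-map _ _ trees treesWithSpine) ⟩
    2 * (length trees + length treesWithSpine)
      ≡⟨ *-distribˡ-+ 2 (length trees) _ ⟩
    2 * length trees + 2 * length treesWithSpine
      ≡⟨ cong₂ (λ a b → a + 2 * b) length-trees length-treesWithSpine ⟩
    2 ^ k * (suc k + 1) + 2 * 2 ^ k
      ≡⟨ factor (2 ^ k) k ⟩
    2 ^ k * (suc k + 3)
      ∎
    where
    open ≡-Reasoning
    factor : ∀ p k → p * (suc k + 1) + 2 * p ≡ p * (suc k + 3)
    factor = solve-∀

corollary3p7 : (n : ℕ) → .{{_ : NonZero n}} →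
    (Σ[ t ∈ ℕ ] (τ≡ (Cone (Star n)) t × (2 * t ≡ 2 ^ (n ∸ 1) * (n + 1)))) ×
    (Σ[ t ∈ ℕ ] (τ≡ (ConePlus (Star n) (centre n)) t × (2 * t ≡ 2 ^ (n ∸ 1) * (n + 3))))
corollary3p7 (suc k) = (length trees  , τ≡-length enum-trees  , length-trees)
                     , (length trees⁺ , τ≡-length enum-trees⁺ , length-trees⁺)
  where
  open ConeOfStar k
  open DoubledSpineConeOfStar k
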